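{- Let $\ell\ge 2$ and let $G$ be an $N$-AW graph of order $n$. Then: (1) no connected component of $\overline{G}$ is a path $P_k$ with $k\equiv 3\pmod 4$; (2) at most one connected component of $\overline{G}$ is a path $P_k$ with $k\equiv 1\pmod 4$; (3) if $G$ is $(n,\ell)$-extremal, then no connected component of $\overline{G}$ is a path of order more than $4$.
   Context: All graphs are finite and simple; labels lie in $\mathbb{Z}_\ell$. In the neighborhood Lights Out game on a graph $G$, each vertex carries a label in $\mathbb{Z}_\ell$; toggling a vertex $v$ adds $1$ (mod $\ell$) to the label of every vertex of the closed neighborhood $N[v]$; the game is won when all labels are $0$. $G$ is $N$-AW if the game can be won from every initial labeling. $\max(n,\ell)$ is the maximum number of edges of an $N$-AW graph on $n$ vertices; an $(n,\ell)$-extremal graph is an $N$-AW graph on $n$ vertices with $\max(n,\ell)$ edges. $P_k$ is the path on $k$ vertices; $\overline{G}$ is the complement of $G$. -}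

module Defs where

open import Data.Bool using (Bool; true; false; not; _∧_; if_then_else_)
open import Data.Nat using (ℕ; zero; suc; _+_; _*_; _<_; _≤_)
open import Data.Nat.Divisibility using (_∣_)
open import Data.Fin using (Fin; toℕ; _≟_)
open import Data.Product using (Σ; ∃; _×_; _,_)
open import Relation.Binary.PropositionalEquality using (_≡_)
open import Relation.Nullary using (¬_)
open import Relation.Nullary.Decidable using (⌊_⌋)
open import Function.Definitions using (Injective)

record Graph (n : ℕ) : Set where
  field
    adj   : Fin n → Fin n → Bool
    adjSym : ∀ i j → adj i j ≡ adj j i
    adjIrr : ∀ i → adj i i ≡ false
open Graph public

sumFin : (n : ℕ) → (Fin n → ℕ) → ℕ
sumFin zero    f = 0
sumFin (suc n) f = f Fin.zero + sumFin n (λ i → f (Fin.suc i))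

inN[_] : {n : ℕ} → Graph n → Fin n → Fin n → Bool
inN[ G ] v u = if ⌊ v ≟ u ⌋ then true else adj G v u

b2n : Bool → ℕ
b2n true  = 1
b2n false = 0

-- After toggling each vertex u exactly t u times, the label of v is
-- init v + Σ_{u ∈ N[v]} t u (mod ℓ).
finalLabel : {n : ℕ} → Graph n → (ℓ : ℕ) → (Fin n → Fin ℓ) → (Fin n → ℕ) → Fin n → ℕ
finalLabel {n} G ℓ init t v = toℕ (init v) + sumFin n (λ u → b2n (inN[ G ] v u) * t u)

-- The game is won from labelling init if some toggling sequence
-- (described by the number of times each vertex is toggled) makes all labels 0 mod ℓ.
Winnable : {n : ℕ} → Graph n → (ℓ : ℕ) → (Fin n → Fin ℓ) → Set
Winnable {n} G ℓ init = ∃ λ (t : Fin n → ℕ) → ∀ v → ℓ ∣ finalLabel G ℓ init t v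

NAW : {n : ℕ} → Graph n → ℕ → Set
NAW G ℓ = ∀ init → Winnable G ℓ init

edges : {n : ℕ} → Graph n → ℕ
edges {n} G = sumFin n (λ i → sumFin n (λ j →
  if ⌊ toℕ i Data.Nat.<? toℕ j ⌋ then b2n (adj G i j) else 0))

Extremal : {n : ℕ} → Graph n → ℕ → Set
Extremal {n} G ℓ = NAW G ℓ × (∀ (H : Graph n) → NAW H ℓ → edges H ≤ edges G)

complement : {n : ℕ} → Graph n → Graph n
complement G = record
  { adj   = λ i j → not (adj G i j) ∧ not ⌊ i ≟ j ⌋
  ; adjSym = symC
  ; adjIrr = irrC }
  where
  open import Relation.Binary.PropositionalEquality using (refl; cong₂; sym)
  open import Relation.Nullary using (yes; no)
  open import Data.Bool.Properties using (∧-zeroʳ)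
  open import Relation.Binary.PropositionalEquality using (cong)
  decSym : ∀ {n} (i j : Fin n) → ⌊ i ≟ j ⌋ ≡ ⌊ j ≟ i ⌋
  decSym i j with i ≟ j | j ≟ i
  ... | yes _ | yes _ = refl
  ... | no _  | no _  = refl
  ... | yes p | no q  = Data.Empty.⊥-elim (q (sym p)) where import Data.Empty
  ... | no p  | yes q = Data.Empty.⊥-elim (p (sym q)) where import Data.Empty
  symC : ∀ i j → (not (adj G i j) ∧ not ⌊ i ≟ j ⌋) ≡ (not (adj G j i) ∧ not ⌊ j ≟ i ⌋)
  symC i j = cong₂ (λ a b → not a ∧ not b) (Graph.adjSym G i j) (decSym i j)
  irrC : ∀ i → (not (adj G i i) ∧ not ⌊ i ≟ i ⌋) ≡ false
  irrC i with i ≟ i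
  ... | yes _ = ∧-zeroʳ _
  ... | no q  = Data.Empty.⊥-elim (q refl) where import Data.Empty

PathAdj : {k : ℕ} → Fin k → Fin k → Set
PathAdj i j = (suc (toℕ i) ≡ toℕ j) Data.Sum.⊎ (suc (toℕ j) ≡ toℕ i)
  where import Data.Sum

-- p : Fin k → Fin n exhibits a connected component of H isomorphic to P_k:
-- p is injective, the induced subgraph on its image is exactly P_k,
-- and the image is closed under H-adjacency (so it is a whole component).
PathComponent : {n : ℕ} → Graph n → (k : ℕ) → (Fin k → Fin n) → Set
PathComponent {n} H k p =
  Injective _≡_ _≡_ p
  × (∀ i j → (adj H (p i) (p j) ≡ true → PathAdj i j) × (PathAdj i j → adj H (p i) (p j) ≡ true))
  × (∀ i (w : Fin n) → adj H (p i) w ≡ true → ∃ λ j → p j ≡ w)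

SameImage : {n k k' : ℕ} → (Fin k → Fin n) → (Fin k' → Fin n) → Set
SameImage p q = (∀ i → ∃ λ j → p i ≡ q j) × (∀ j → ∃ λ i → q j ≡ p i)

-- Over ℤ, pressing buttons applies the closed-neighbourhood operator N = J − Ā, where Ā is the
-- adjacency operator of the complement Ḡ, and G is N-AW iff every integer vector is reached by N
-- modulo ℓ. Since N is symmetric, a vector x with N x = 0 pairs with a solution of N t ≡ e_a to give
-- x_a ≡ 0 (mod ℓ). On a path component P_k of Ḡ the vector 1, 0, −1, 0, 1, … is killed by Ā, and its
-- entries sum to 0 if k ≡ 3 and to 1 if k ≡ 1 (mod 4); so N annihilates it in the first case, and
-- the difference of two such vectors on disjoint components in the second. On a component of order
-- at least 5, the vector (1, 0, −1) on p₀ p₁ p₂ has N x = e_{p₃} and vanishes at p₃ and p₄; this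
-- keeps e_{p₃} and e_{p₄} reachable after adding the edge p₃p₄, so an extremal G cannot have one.

module Submission where

open import Defs
open import Data.Nat using (ℕ; _≤_; _<_; _%_)
open import Data.Fin using (Fin)
open import Data.Product using (_×_)
open import Relation.Binary.PropositionalEquality using (_≡_)
open import Relation.Nullary using (¬_)

open import Data.Bool using (Bool; true; false; _∧_; _∨_; if_then_else_)
open import Data.Bool.Properties using (∨-comm; ∧-comm)
open import Data.Empty using (⊥; ⊥-elim)
open import Data.Fin as Fin using (toℕ; fromℕ<)
open import Data.Fin.Properties using (toℕ-fromℕ<; toℕ-injective; toℕ<n)
import Data.Fin.Properties as Fin
open import Data.Integer as ℤ using (ℤ; +_; -_; _+_; _-_; _*_; 0ℤ; 1ℤ; _%ℕ_; _/ℕ_)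
open import Data.Integer.DivMod using (n%ℕd<d; a≡a%ℕn+[a/ℕn]*n)
open import Data.Integer.Divisibility.Signed
  using (_∣_; divides; ∣m∣n⇒∣m+n; ∣m∣n⇒∣m-n; ∣m⇒∣-m; ∣n⇒∣m*n; ∣ᵤ⇒∣; ∣⇒∣ᵤ)
open import Data.Integer.Properties
  using (+-*-semiring; +-*-ring; +-comm; +-injective; +-inverseʳ; +-identityˡ; +-identityʳ; *-identityˡ; *-zeroˡ; *-zeroʳ;
         *-comm; *-assoc; *-distribˡ-+; *-distribʳ-+; neg-distrib-+; neg-distribʳ-*; pos-+; pos-*)
open import Data.Integer.Tactic.RingSolver using (solve-∀)
open import Algebra.Properties.Ring +-*-ring using (x[y-z]≈xy-xz)
open import Algebra.Properties.Semiring.Sum +-*-semiring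
  using (sum; sum-syntax; sum-cong-≗; sum-replicate-zero; ∑-distrib-+; ∑-comm; *-distribˡ-sum; *-distribʳ-sum)
open import Data.Nat as ℕ using (zero; suc; _≡ᵇ_; _∸_; NonZero)
open import Data.Nat.Divisibility using (∣1⇒≡1)
import Data.Nat.DivMod as ℕ
import Data.Nat.Properties as ℕ
open import Data.Product using (∃; _,_; proj₁; proj₂)
open import Data.Sum using (_⊎_; inj₁; inj₂)
open import Data.Vec.Functional using (Vector)
open import Function using (_∘_; _$_; id)
open import Function.Definitions using (Injective)
open import Relation.Binary.PropositionalEquality using (_≢_; refl; sym; trans; cong; cong₂; subst; subst₂; module ≡-Reasoning)
open import Relation.Nullary using (yes; no)
open import Relation.Nullary.Decidable using (⌊_⌋)
open import Relation.Nullary.Negation using (contradiction)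

-- Integer vectors on Fin n

⟦_⟧ : Bool → ℤ
⟦ b ⟧ = + b2n b

δ : ℕ → ℕ → ℤ
δ m n = ⟦ m ≡ᵇ n ⟧

δ-refl : ∀ m → δ m m ≡ 1ℤ
δ-refl zero    = refl
δ-refl (suc m) = δ-refl m

δ-≢ : ∀ {m n} → m ≢ n → δ m n ≡ 0ℤ
δ-≢ {zero}  {zero}  m≢n = contradiction refl m≢n
δ-≢ {zero}  {suc n} _   = refl
δ-≢ {suc m} {zero}  _   = refl
δ-≢ {suc m} {suc n} m≢n = δ-≢ (m≢n ∘ cong suc)

basis : ∀ {n} → Fin n → Vector ℤ n
basis a u = δ (toℕ a) (toℕ u)

∑-zero : ∀ n (f : Vector ℤ n) → (∀ i → f i ≡ 0ℤ) → sum f ≡ 0ℤ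
∑-zero n f f≡0 = trans (sum-cong-≗ f≡0) (sum-replicate-zero n)

∑-neg : ∀ {n} (f : Vector ℤ n) → ∑[ i < n ] (- f i) ≡ - sum f
∑-neg {zero}  f = refl
∑-neg {suc n} f = trans (cong (_+_ (- f Fin.zero)) (∑-neg (f ∘ Fin.suc))) (sym (neg-distrib-+ (f Fin.zero) (sum (f ∘ Fin.suc))))

∑-distrib-- : ∀ {n} (f g : Vector ℤ n) → ∑[ i < n ] (f i - g i) ≡ sum f - sum g
∑-distrib-- f g = trans (∑-distrib-+ f (-_ ∘ g)) (cong (_+_ (sum f)) (∑-neg g))

∑-basis : ∀ {n} (a : Fin n) (f : Vector ℤ n) → ∑[ u < n ] (basis a u * f u) ≡ f a
∑-basis {suc n} Fin.zero f = begin
  1ℤ * f Fin.zero + ∑[ u < n ] (0ℤ * f (Fin.suc u))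
    ≡⟨ cong₂ _+_ (*-identityˡ (f Fin.zero)) (∑-zero n _ (λ u → *-zeroˡ (f (Fin.suc u)))) ⟩
  f Fin.zero + 0ℤ
    ≡⟨ +-identityʳ _ ⟩
  f Fin.zero
    ∎
  where open ≡-Reasoning
∑-basis {suc n} (Fin.suc a) f =
  trans (cong (_+ sum (λ u → basis a u * f (Fin.suc u))) (*-zeroˡ (f Fin.zero))) (trans (+-identityˡ _) (∑-basis a (f ∘ Fin.suc)))

∣-∑ : ∀ {d n} (f : Vector ℤ n) → (∀ i → d ∣ f i) → d ∣ sum f
∣-∑ {d} {zero}  f _   = divides 0ℤ (sym (*-zeroˡ d))
∣-∑ {d} {suc n} f d∣f = ∣m∣n⇒∣m+n (d∣f _) (∣-∑ (f ∘ Fin.suc) (d∣f ∘ Fin.suc))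

+-sumFin : ∀ n (f : Fin n → ℕ) → + sumFin n f ≡ ∑[ i < n ] (+ f i)
+-sumFin zero    f = refl
+-sumFin (suc n) f = trans (pos-+ (f _) _) (cong (_+_ (+ f _)) (+-sumFin n (f ∘ Fin.suc)))

⟨_,_⟩ : ∀ {n} → Vector ℤ n → Vector ℤ n → ℤ
⟨_,_⟩ {n} x y = ∑[ i < n ] (x i * y i)

⟨⟩-basisʳ : ∀ {n} (x : Vector ℤ n) a → ⟨ x , basis a ⟩ ≡ x a
⟨⟩-basisʳ x a = trans (sum-cong-≗ (λ u → *-comm (x u) (basis a u))) (∑-basis a x)

basis-subst : ∀ {n} (a : Fin n) (g : Vector ℤ n) i → basis a i * g i ≡ basis a i * g a
basis-subst a g i with a Fin.≟ i
... | yes refl = refl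
... | no a≢i   = trans (cong (_* g i) a·i≡0) (sym (cong (_* g a) a·i≡0))
  where
  a·i≡0 : basis a i ≡ 0ℤ
  a·i≡0 = δ-≢ (a≢i ∘ toℕ-injective)

basis-disjoint : ∀ {n} {a b : Fin n} → a ≢ b → ∀ i → basis a i * basis b i ≡ 0ℤ
basis-disjoint {a = a} {b} a≢b i =
  trans (basis-subst a (basis b) i) (trans (cong (basis a i *_) (δ-≢ (a≢b ∘ sym ∘ toℕ-injective))) (*-zeroʳ (basis a i)))

⟦∧⟧ : ∀ x y → ⟦ x ∧ y ⟧ ≡ ⟦ x ⟧ * ⟦ y ⟧
⟦∧⟧ true  true  = refl
⟦∧⟧ true  false = refl
⟦∧⟧ false y     = refl

⟦∨⟧ : ∀ x y → ⟦ x ⟧ * ⟦ y ⟧ ≡ 0ℤ → ⟦ x ∨ y ⟧ ≡ ⟦ x ⟧ + ⟦ y ⟧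
⟦∨⟧ true  true  ()
⟦∨⟧ true  false _ = refl
⟦∨⟧ false y     _ = refl

⟦⟧≡0 : ∀ {x} → ⟦ x ⟧ ≡ 0ℤ → x ≡ false
⟦⟧≡0 {false} _ = refl

-- The closed-neighbourhood operator

N[_]·_ : ∀ {n} → Graph n → Vector ℤ n → Vector ℤ n
N[_]·_ {n} G t v = ∑[ u < n ] (⟦ inN[ G ] v u ⟧ * t u)

Ā[_]·_ : ∀ {n} → Graph n → Vector ℤ n → Vector ℤ n
Ā[_]·_ {n} G t v = ∑[ u < n ] (⟦ adj (complement G) v u ⟧ * t u)

inN-complement : ∀ {n} (G : Graph n) v u → ⟦ inN[ G ] v u ⟧ ≡ 1ℤ - ⟦ adj (complement G) v u ⟧
inN-complement G v u with ⌊ v Fin.≟ u ⌋ | adj G v u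
... | true  | true  = refl
... | true  | false = refl
... | false | true  = refl
... | false | false = refl

N·≡∑-Ā· : ∀ {n} (G : Graph n) t v → (N[ G ]· t) v ≡ sum t - (Ā[ G ]· t) v
N·≡∑-Ā· {n} G t v = begin
  ∑[ u < n ] (⟦ inN[ G ] v u ⟧ * t u)          ≡⟨ sum-cong-≗ (λ u → cong (_* t u) (inN-complement G v u)) ⟩
  ∑[ u < n ] ((1ℤ - ⟦ Ā v u ⟧) * t u)           ≡⟨ sum-cong-≗ (λ u → expand ⟦ Ā v u ⟧ (t u)) ⟩
  ∑[ u < n ] (t u - ⟦ Ā v u ⟧ * t u)            ≡⟨ ∑-distrib-- t (λ u → ⟦ Ā v u ⟧ * t u) ⟩
  sum t - (Ā[ G ]· t) v                         ∎
  where
  open ≡-Reasoning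
  Ā = adj (complement G)
  expand : ∀ a b → (1ℤ - a) * b ≡ b - a * b
  expand = solve-∀

inN-sym : ∀ {n} (G : Graph n) v u → inN[ G ] v u ≡ inN[ G ] u v
inN-sym G v u with v Fin.≟ u | u Fin.≟ v
... | yes _   | yes _   = refl
... | no _    | no _    = adjSym G v u
... | yes v≡u | no u≢v  = contradiction (sym v≡u) u≢v
... | no v≢u  | yes u≡v = contradiction (sym u≡v) v≢u

N·-selfAdjoint : ∀ {n} (G : Graph n) x t → ⟨ x , N[ G ]· t ⟩ ≡ ⟨ N[ G ]· x , t ⟩
N·-selfAdjoint {n} G x t = begin
  ∑[ v < n ] (x v * ∑[ u < n ] (c v u * t u))     ≡⟨ sum-cong-≗ (λ v → *-distribˡ-sum (x v) (λ u → c v u * t u)) ⟩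
  ∑[ v < n ] ∑[ u < n ] (x v * (c v u * t u))     ≡⟨ ∑-comm (λ v u → x v * (c v u * t u)) ⟩
  ∑[ u < n ] ∑[ v < n ] (x v * (c v u * t u))
    ≡⟨ sum-cong-≗ (λ u → sum-cong-≗ (λ v → swap (x v) (t u) (cong ⟦_⟧ (inN-sym G v u)))) ⟩
  ∑[ u < n ] ∑[ v < n ] (c u v * x v * t u)       ≡⟨ sum-cong-≗ (λ u → *-distribʳ-sum (t u) (λ v → c u v * x v)) ⟨
  ∑[ u < n ] (∑[ v < n ] (c u v * x v) * t u)     ∎
  where
  open ≡-Reasoning
  c = λ v u → ⟦ inN[ G ] v u ⟧
  swap : ∀ a b {c d} → c ≡ d → a * (c * b) ≡ d * a * b
  swap a b {c} refl = trans (sym (*-assoc a c b)) (cong (_* b) (*-comm a c))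

N·-+ : ∀ {n} (G : Graph n) s t v → (N[ G ]· (λ u → s u + t u)) v ≡ (N[ G ]· s) v + (N[ G ]· t) v
N·-+ G s t v =
  trans (sum-cong-≗ (λ u → *-distribˡ-+ (c u) (s u) (t u))) (∑-distrib-+ (λ u → c u * s u) (λ u → c u * t u))
  where
  c = λ u → ⟦ inN[ G ] v u ⟧

N·-* : ∀ {n} (G : Graph n) c t v → (N[ G ]· (λ u → c * t u)) v ≡ c * (N[ G ]· t) v
N·-* G c t v =
  trans (sum-cong-≗ (λ u → x*[c*y]≡c*[x*y] ⟦ inN[ G ] v u ⟧ c (t u))) (sym (*-distribˡ-sum c (λ u → ⟦ inN[ G ] v u ⟧ * t u)))
  where
  x*[c*y]≡c*[x*y] : ∀ x c y → x * (c * y) ≡ c * (x * y)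
  x*[c*y]≡c*[x*y] = solve-∀

N·-- : ∀ {n} (G : Graph n) s t v → (N[ G ]· (λ u → s u - t u)) v ≡ (N[ G ]· s) v - (N[ G ]· t) v
N·-- {n} G s t v =
  trans (sum-cong-≗ {n} (λ u → x[y-z]≈xy-xz (c u) (s u) (t u))) (∑-distrib-- (λ u → c u * s u) (λ u → c u * t u))
  where
  c = λ u → ⟦ inN[ G ] v u ⟧

-- Solvability modulo ℓ

infix 4 _≡_[mod_]

_≡_[mod_] : ℤ → ℤ → ℕ → Set
a ≡ b [mod ℓ ] = + ℓ ∣ a - b

≡mod-refl : ∀ {a ℓ} → a ≡ a [mod ℓ ]
≡mod-refl {a} = divides 0ℤ (+-inverseʳ a)

≡mod-sym : ∀ {a b ℓ} → a ≡ b [mod ℓ ] → b ≡ a [mod ℓ ]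
≡mod-sym {a} {b} a≡b = subst (_ ∣_) (-[a-b]≡b-a a b) (∣m⇒∣-m a≡b)
  where
  -[a-b]≡b-a : ∀ a b → - (a - b) ≡ b - a
  -[a-b]≡b-a = solve-∀

≡mod-trans : ∀ {a b c ℓ} → a ≡ b [mod ℓ ] → b ≡ c [mod ℓ ] → a ≡ c [mod ℓ ]
≡mod-trans {a} {b} {c} a≡b b≡c = subst (_ ∣_) (telescope a b c) (∣m∣n⇒∣m+n a≡b b≡c)
  where
  telescope : ∀ a b c → a - b + (b - c) ≡ a - c
  telescope = solve-∀

%ℕ-≡mod : ∀ a ℓ .{{_ : NonZero ℓ}} → a ≡ + (a %ℕ ℓ) [mod ℓ ]
%ℕ-≡mod a ℓ = divides (a /ℕ ℓ) (begin
  a - + (a %ℕ ℓ)                           ≡⟨ cong (_- + (a %ℕ ℓ)) (a≡a%ℕn+[a/ℕn]*n a ℓ) ⟩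
  + (a %ℕ ℓ) + (a /ℕ ℓ) * + ℓ - + (a %ℕ ℓ) ≡⟨ r+x-r≡x (+ (a %ℕ ℓ)) ((a /ℕ ℓ) * + ℓ) ⟩
  (a /ℕ ℓ) * + ℓ                           ∎)
  where
  open ≡-Reasoning
  r+x-r≡x : ∀ r x → r + x - r ≡ x
  r+x-r≡x = solve-∀

N·-resp-≡mod : ∀ {n ℓ} (G : Graph n) {s t} → (∀ u → s u ≡ t u [mod ℓ ]) →
  ∀ v → (N[ G ]· s) v ≡ (N[ G ]· t) v [mod ℓ ]
N·-resp-≡mod {n} G {s} {t} s≡t v =
  subst (_ ∣_) (N·-- G s t v) (∣-∑ {n = n} (λ u → c u * (s u - t u)) (λ u → ∣n⇒∣m*n (c u) (s≡t u)))
  where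
  c = λ u → ⟦ inN[ G ] v u ⟧

Reachable : ∀ {n} → Graph n → ℕ → Vector ℤ n → Set
Reachable {n} G ℓ y = ∃ λ (t : Vector ℤ n) → ∀ v → (N[ G ]· t) v ≡ y v [mod ℓ ]

NAWℤ : ∀ {n} → Graph n → ℕ → Set
NAWℤ G ℓ = ∀ y → Reachable G ℓ y

Reachable-resp : ∀ {n ℓ} (G : Graph n) {y z} → (∀ v → y v ≡ z v [mod ℓ ]) → Reachable G ℓ z → Reachable G ℓ y
Reachable-resp G {y} {z} y≡z (t , N·t≡z) = t , λ v →
  ≡mod-trans {(N[ G ]· t) v} {z v} {y v} (N·t≡z v) (≡mod-sym {y v} {z v} (y≡z v))

Reachable-image : ∀ {n ℓ} (G : Graph n) t → Reachable G ℓ (N[ G ]· t)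
Reachable-image G t = t , λ v → ≡mod-refl {(N[ G ]· t) v}

Reachable-lincomb : ∀ {n ℓ} (G : Graph n) {y z} → Reachable G ℓ y → Reachable G ℓ z → ∀ c →
  Reachable G ℓ (λ v → y v + c * z v)
Reachable-lincomb G {y} {z} (t , N·t≡y) (s , N·s≡z) c = (λ u → t u + c * s u) , λ v →
  subst (_ ∣_) (sym (regroup v)) (∣m∣n⇒∣m+n (N·t≡y v) (∣n⇒∣m*n c (N·s≡z v)))
  where
  rearrange : ∀ a b c y z → a + c * b - (y + c * z) ≡ a - y + c * (b - z)
  rearrange = solve-∀
  regroup : ∀ v → (N[ G ]· (λ u → t u + c * s u)) v - (y v + c * z v) ≡ (N[ G ]· t) v - y v + c * ((N[ G ]· s) v - z v)
  regroup v = trans (cong (_- (y v + c * z v)) (trans (N·-+ G t (λ u → c * s u) v) (cong (_+_ ((N[ G ]· t) v)) (N·-* G c s v))))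
                    (rearrange ((N[ G ]· t) v) ((N[ G ]· s) v) c (y v) (z v))

+finalLabel : ∀ {n} (G : Graph n) ℓ init t v →
  + finalLabel G ℓ init t v ≡ + toℕ (init v) + (N[ G ]· (+_ ∘ t)) v
+finalLabel {n} G ℓ init t v = trans (pos-+ (toℕ (init v)) _) (cong (_+_ (+ toℕ (init v)))
  (trans (+-sumFin n _) (sum-cong-≗ (λ u → pos-* (b2n (inN[ G ] v u)) (t u)))))

NAW⇒NAWℤ : ∀ {n} ℓ .{{_ : NonZero ℓ}} (G : Graph n) → NAW G ℓ → NAWℤ G ℓ
NAW⇒NAWℤ ℓ G naw y = +_ ∘ t , λ v →
  subst (_ ∣_) (regroup (+ r v) ((N[ G ]· (+_ ∘ t)) v) (y v))
    (∣m∣n⇒∣m+n (subst (_ ∣_) (trans (+finalLabel G ℓ init t v) (cong (λ z → + z + (N[ G ]· (+_ ∘ t)) v) (toℕ-init v)))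
                             (∣ᵤ⇒∣ (won v)))
               (%ℕ-≡mod (- y v) ℓ))
  where
  r = λ v → (- y v) %ℕ ℓ
  init = λ v → fromℕ< (n%ℕd<d (- y v) ℓ)
  toℕ-init : ∀ v → toℕ (init v) ≡ r v
  toℕ-init v = toℕ-fromℕ< (n%ℕd<d (- y v) ℓ)
  t = proj₁ (naw init)
  won = proj₂ (naw init)
  regroup : ∀ r a y → r + a + (- y - r) ≡ a - y
  regroup = solve-∀

NAWℤ⇒NAW : ∀ {n} ℓ .{{_ : NonZero ℓ}} (G : Graph n) → NAWℤ G ℓ → NAW G ℓ
NAWℤ⇒NAW ℓ G nawℤ init = T , λ v →
  ∣⇒∣ᵤ (subst (_ ∣_) (trans (regroup (+ toℕ (init v)) (N·t v) (N·T v)) (sym (+finalLabel G ℓ init T v)))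
    (∣m∣n⇒∣m-n (solved v) (N·-resp-≡mod G (λ u → %ℕ-≡mod (t u) ℓ) v)))
  where
  t = proj₁ (nawℤ (λ v → - + toℕ (init v)))
  solved = proj₂ (nawℤ (λ v → - + toℕ (init v)))
  T = λ u → t u %ℕ ℓ
  N·t = N[ G ]· t
  N·T = N[ G ]· (+_ ∘ T)
  regroup : ∀ i a b → a - (- i) - (a - b) ≡ i + b
  regroup = solve-∀

pairing : ∀ {n ℓ} (G : Graph n) {t y} x → (∀ v → (N[ G ]· t) v ≡ y v [mod ℓ ]) →
  ⟨ N[ G ]· x , t ⟩ ≡ ⟨ x , y ⟩ [mod ℓ ]
pairing {n} G {t} {y} x Nt≡y = subst (_ ∣_) eq (∣-∑ _ (λ v → ∣n⇒∣m*n (x v) (Nt≡y v)))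
  where
  open ≡-Reasoning
  eq : ∑[ v < n ] (x v * ((N[ G ]· t) v - y v)) ≡ ⟨ N[ G ]· x , t ⟩ - ⟨ x , y ⟩
  eq = begin
    ∑[ v < n ] (x v * ((N[ G ]· t) v - y v))        ≡⟨ sum-cong-≗ (λ v → x[y-z]≈xy-xz (x v) ((N[ G ]· t) v) (y v)) ⟩
    ∑[ v < n ] (x v * (N[ G ]· t) v - x v * y v)     ≡⟨ ∑-distrib-- (λ v → x v * (N[ G ]· t) v) (λ v → x v * y v) ⟩
    ⟨ x , N[ G ]· t ⟩ - ⟨ x , y ⟩                    ≡⟨ cong (_- ⟨ x , y ⟩) (N·-selfAdjoint G x t) ⟩
    ⟨ N[ G ]· x , t ⟩ - ⟨ x , y ⟩                    ∎

kernel-≡0 : ∀ {n ℓ} (G : Graph n) → NAWℤ G ℓ →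
  ∀ x → (∀ v → (N[ G ]· x) v ≡ 0ℤ) → ∀ a → x a ≡ 0ℤ [mod ℓ ]
kernel-≡0 {n} {ℓ} G nawℤ x N·x≡0 a =
  ≡mod-sym {0ℤ} {x a} (subst₂ (λ u w → u ≡ w [mod ℓ ]) ⟨N·x,t⟩≡0 (⟨⟩-basisʳ x a) (pairing G x solved))
  where
  t = proj₁ (nawℤ (basis a))
  solved = proj₂ (nawℤ (basis a))
  ⟨N·x,t⟩≡0 : ⟨ N[ G ]· x , t ⟩ ≡ 0ℤ
  ⟨N·x,t⟩≡0 = ∑-zero n _ (λ v → cong (_* t v) (N·x≡0 v))

1≢0[mod] : ∀ {ℓ} → 2 ≤ ℓ → ¬ (1ℤ ≡ 0ℤ [mod ℓ ])
1≢0[mod] 2≤ℓ ℓ∣1 = contradiction (subst (2 ≤_) (∣1⇒≡1 (∣⇒∣ᵤ ℓ∣1)) 2≤ℓ) λ { (ℕ.s≤s ()) }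

¬NAWℤ-kernel : ∀ {n ℓ} → 2 ≤ ℓ → (G : Graph n) → NAWℤ G ℓ →
  ∀ x a → (∀ v → (N[ G ]· x) v ≡ 0ℤ) → x a ≡ 1ℤ → ⊥
¬NAWℤ-kernel 2≤ℓ G nawℤ x a N·x≡0 xa≡1 =
  1≢0[mod] 2≤ℓ (subst (λ z → z ≡ 0ℤ [mod _ ]) xa≡1 (kernel-≡0 G nawℤ x N·x≡0 a))

-- The alternating vector on a path

-- alternating c is 1, 0, −1, 0, …, ±1 of length 2c + 1 followed by zeros; lengths are written
-- suc (c * 2) because suc c * 2 reduces to suc (suc (c * 2)).
alternating : ℕ → ℕ → ℤ
alternating zero    zero                = 1ℤ
alternating zero    (suc m)             = 0ℤ
alternating (suc c) zero                = 1ℤ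
alternating (suc c) (suc zero)          = 0ℤ
alternating (suc c) (suc (suc m))       = - alternating c m

neighbourSum : (ℕ → ℤ) → ℕ → ℤ
neighbourSum g zero    = g 1
neighbourSum g (suc m) = g (suc (suc m)) + g m

alternating-head : ∀ c → alternating c 0 ≡ 1ℤ
alternating-head zero    = refl
alternating-head (suc c) = refl

alternating-support : ∀ c m → suc (c ℕ.* 2) ≤ m → alternating c m ≡ 0ℤ
alternating-support zero    (suc m)             _                     = refl
alternating-support (suc c) (suc (suc m)) (ℕ.s≤s (ℕ.s≤s c*2<m)) = cong -_ (alternating-support c m c*2<m)

neighbourSum-alternating : ∀ c m →
  neighbourSum (alternating c) m ≡ δ (suc (c ℕ.* 2)) m * alternating c (c ℕ.* 2)
neighbourSum-alternating zero    zero          = refl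
neighbourSum-alternating zero    (suc zero)    = refl
neighbourSum-alternating zero    (suc (suc m)) = refl
neighbourSum-alternating (suc c) zero          = refl
neighbourSum-alternating (suc c) (suc zero)    = cong (λ z → - z + 1ℤ) (alternating-head c)
neighbourSum-alternating (suc c) (suc (suc m)) = begin
  - alternating c (suc m) + alternating (suc c) (suc m)           ≡⟨ shifted m ⟩
  - neighbourSum (alternating c) m                                ≡⟨ cong -_ (neighbourSum-alternating c m) ⟩
  - (δ (suc (c ℕ.* 2)) m * alternating c (c ℕ.* 2))               ≡⟨ neg-distribʳ-* (δ (suc (c ℕ.* 2)) m) _ ⟩
  δ (suc (c ℕ.* 2)) m * - alternating c (c ℕ.* 2)                 ∎
  where
  open ≡-Reasoning
  shifted : ∀ m → - alternating c (suc m) + alternating (suc c) (suc m) ≡ - neighbourSum (alternating c) m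
  shifted zero    = +-identityʳ _
  shifted (suc m) = sym (neg-distrib-+ (alternating c (suc (suc m))) (alternating c m))

∑-alternating-suc : ∀ c k →
  ∑[ j < suc (suc k) ] alternating (suc c) (toℕ j) ≡ 1ℤ + (0ℤ + - ∑[ j < k ] alternating c (toℕ j))
∑-alternating-suc c k = cong (λ z → 1ℤ + (0ℤ + z)) (∑-neg {k} (alternating c ∘ toℕ))

mutual
  ∑-alternating-even : ∀ r k → suc (r ℕ.* 2 ℕ.* 2) ≤ k → ∑[ j < k ] alternating (r ℕ.* 2) (toℕ j) ≡ 1ℤ
  ∑-alternating-even zero    (suc k)       _ = cong (_+_ 1ℤ) (∑-zero k (λ j → alternating 0 (suc (toℕ j))) (λ _ → refl))
  ∑-alternating-even (suc r) (suc (suc k)) (ℕ.s≤s (ℕ.s≤s le)) =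
    trans (∑-alternating-suc (suc (r ℕ.* 2)) k) (cong (λ z → 1ℤ + (0ℤ + - z)) (∑-alternating-odd r k le))

  ∑-alternating-odd : ∀ r k → suc (suc (r ℕ.* 2) ℕ.* 2) ≤ k → ∑[ j < k ] alternating (suc (r ℕ.* 2)) (toℕ j) ≡ 0ℤ
  ∑-alternating-odd r (suc (suc k)) (ℕ.s≤s (ℕ.s≤s le)) =
    trans (∑-alternating-suc (r ℕ.* 2) k) (cong (λ z → 1ℤ + (0ℤ + - z)) (∑-alternating-even r k le))

∑-δ-supported : ∀ k (g : ℕ → ℤ) → (∀ m → k ≤ m → g m ≡ 0ℤ) →
  ∀ m → ∑[ j < k ] (δ m (toℕ j) * g (toℕ j)) ≡ g m
∑-δ-supported zero    g supp m       = sym (supp m ℕ.z≤n)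
∑-δ-supported (suc k) g supp zero    = trans
  (cong₂ _+_ (*-identityˡ (g 0)) (∑-zero k _ (λ j → *-zeroˡ (g (suc (toℕ j))))))
  (+-identityʳ (g 0))
∑-δ-supported (suc k) g supp (suc m) = trans
  (cong (_+_ (0ℤ * g 0)) (∑-δ-supported k (g ∘ suc) (λ m k≤m → supp (suc m) (ℕ.s≤s k≤m)) m))
  (+-identityˡ (g (suc m)))

∑-δ-neighbours : ∀ k (g : ℕ → ℤ) → (∀ m → k ≤ m → g m ≡ 0ℤ) →
  ∀ m → ∑[ j < k ] ((δ (suc m) (toℕ j) + δ m (suc (toℕ j))) * g (toℕ j)) ≡ neighbourSum g m
∑-δ-neighbours k g supp m = trans (sum-cong-≗ {k} (λ j → *-distribʳ-+ (g (toℕ j)) (δ (suc m) (toℕ j)) (δ m (suc (toℕ j)))))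
  (trans (∑-distrib-+ {k} (λ j → δ (suc m) (toℕ j) * g (toℕ j)) (λ j → δ m (suc (toℕ j)) * g (toℕ j)))
         (split m))
  where
  split : ∀ m → ∑[ j < k ] (δ (suc m) (toℕ j) * g (toℕ j)) + ∑[ j < k ] (δ m (suc (toℕ j)) * g (toℕ j))
              ≡ neighbourSum g m
  split zero    = trans (cong₂ _+_ (∑-δ-supported k g supp 1) (∑-zero k _ (λ _ → refl))) (+-identityʳ (g 1))
  split (suc m) = cong₂ _+_ (∑-δ-supported k g supp (suc (suc m))) (∑-δ-supported k g supp m)

along : ∀ {n k} → (Fin k → Fin n) → (ℕ → ℤ) → Vector ℤ n
along {k = k} p g v = ∑[ j < k ] (basis (p j) v * g (toℕ j))

⟨⟩-along : ∀ {n k} (p : Fin k → Fin n) g (c : Vector ℤ n) →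
  ⟨ c , along p g ⟩ ≡ ∑[ j < k ] (c (p j) * g (toℕ j))
⟨⟩-along {n} {k} p g c = begin
  ∑[ u < n ] (c u * ∑[ j < k ] (basis (p j) u * g (toℕ j)))
    ≡⟨ sum-cong-≗ (λ u → *-distribˡ-sum (c u) (λ j → basis (p j) u * g (toℕ j))) ⟩
  ∑[ u < n ] ∑[ j < k ] (c u * (basis (p j) u * g (toℕ j)))
    ≡⟨ ∑-comm (λ u j → c u * (basis (p j) u * g (toℕ j))) ⟩
  ∑[ j < k ] ∑[ u < n ] (c u * (basis (p j) u * g (toℕ j)))
    ≡⟨ sum-cong-≗ (λ j → sum-cong-≗ (λ u → rearrange (c u) (basis (p j) u) (g (toℕ j)))) ⟩
  ∑[ j < k ] ∑[ u < n ] (basis (p j) u * c u * g (toℕ j))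
    ≡⟨ sum-cong-≗ (λ j → *-distribʳ-sum (g (toℕ j)) (λ u → basis (p j) u * c u)) ⟨
  ∑[ j < k ] (∑[ u < n ] (basis (p j) u * c u) * g (toℕ j))
    ≡⟨ sum-cong-≗ (λ j → cong (_* g (toℕ j)) (∑-basis (p j) c)) ⟩
  ∑[ j < k ] (c (p j) * g (toℕ j))
    ∎
  where
  open ≡-Reasoning
  rearrange : ∀ x y z → x * (y * z) ≡ y * x * z
  rearrange = solve-∀

∑-along : ∀ {n k} (p : Fin k → Fin n) g → sum (along p g) ≡ ∑[ j < k ] g (toℕ j)
∑-along {n} {k} p g = trans (sum-cong-≗ {n} (λ v → sym (*-identityˡ (along p g v))))
  (trans (⟨⟩-along p g (λ _ → 1ℤ)) (sum-cong-≗ {k} (λ j → *-identityˡ (g (toℕ j)))))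

along-basis : ∀ {n k} (p : Fin k → Fin n) i e v → along p (λ m → δ (toℕ i) m * e) v ≡ basis (p i) v * e
along-basis {k = k} p i e v = trans (sum-cong-≗ (λ j → swap (basis (p j) v) (basis i j) e)) (∑-basis i (λ j → basis (p j) v * e))
  where
  swap : ∀ x y z → x * (y * z) ≡ y * (x * z)
  swap = solve-∀

along-vanishing : ∀ {n k} (p : Fin k → Fin n) g → (∀ j → g (toℕ j) ≡ 0ℤ) → ∀ v → along p g v ≡ 0ℤ
along-vanishing {k = k} p g g≡0 v = ∑-zero k _ (λ j → trans (cong (basis (p j) v *_) (g≡0 j)) (*-zeroʳ (basis (p j) v)))

along-outside : ∀ {n k} (p : Fin k → Fin n) g v → (∀ j → p j ≢ v) → along p g v ≡ 0ℤ
along-outside {k = k} p g v v∉p = ∑-zero k _ (λ j → cong (_* g (toℕ j)) (δ-≢ (v∉p j ∘ toℕ-injective)))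

along-at : ∀ {n k} {p : Fin k → Fin n} → Injective _≡_ _≡_ p → ∀ g i → along p g (p i) ≡ g (toℕ i)
along-at {k = k} {p} p-inj g i = trans (sum-cong-≗ (λ j → cong (_* g (toℕ j)) (basis-inj j))) (∑-basis i (g ∘ toℕ))
  where
  basis-inj : ∀ j → basis (p j) (p i) ≡ basis i j
  basis-inj j with j Fin.≟ i
  ... | yes refl = trans (δ-refl (toℕ (p i))) (sym (δ-refl (toℕ i)))
  ... | no j≢i   = trans (δ-≢ (j≢i ∘ p-inj ∘ toℕ-injective)) (sym (δ-≢ (j≢i ∘ sym ∘ toℕ-injective)))

-- Path components of the complement

AdjacencyClosed : ∀ {n} → Graph n → (Fin n → Set) → Set
AdjacencyClosed H S = ∀ {v w} → S v → adj H v w ≡ true → S w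

PathComponent-upward : ∀ {n} {H : Graph n} {k} {p : Fin k → Fin n} → PathComponent H k p →
  ∀ {S} → AdjacencyClosed H S → ∀ i j → toℕ i ≤ toℕ j → S (p i) → S (p j)
PathComponent-upward {k = k} {p} (_ , adjacency , _) {S} closed i j i≤j =
  walk (toℕ j ∸ toℕ i) j (ℕ.m∸n+n≡m i≤j)
  where
  walk : ∀ d j → d ℕ.+ toℕ i ≡ toℕ j → S (p i) → S (p j)
  walk zero    j e s = subst (S ∘ p) (toℕ-injective e) s
  walk (suc d) j e s = closed (walk d j′ (sym (toℕ-fromℕ< d+i<k)) s)
                              (proj₂ (adjacency j′ j) (inj₁ (trans (cong suc (toℕ-fromℕ< d+i<k)) e)))
    where
    d+i<k : d ℕ.+ toℕ i < k
    d+i<k = ℕ.<⇒≤ (subst (_< k) (sym e) (toℕ<n j))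
    j′ = fromℕ< d+i<k

PathComponent-connected : ∀ {n} {H : Graph n} {k} {p : Fin k → Fin n} → PathComponent H k p →
  ∀ {S} → AdjacencyClosed H S → ∀ i j → S (p i) → S (p j)
PathComponent-connected {H = H} {p = p} pc {S} closed i j with ℕ.≤-total (toℕ i) (toℕ j)
... | inj₁ i≤j = PathComponent-upward {H = H} {p = p} pc {S} closed i j i≤j
... | inj₂ j≤i = λ s → PathComponent-upward {H = H} {p = p} pc {λ v → S v → S (p j)} closed⁻ j i j≤i id s
  where
  closed⁻ : AdjacencyClosed H (λ v → S v → S (p j))
  closed⁻ f vw s = f (closed s (trans (adjSym H _ _) vw))

PathComponent-sameImage : ∀ {n} {H : Graph n} {k k′} {p : Fin k → Fin n} {q : Fin k′ → Fin n} →
  PathComponent H k p → PathComponent H k′ q → ∀ {i j} → p i ≡ q j → SameImage p q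
PathComponent-sameImage {n} {H} {p = p} {q} pc qc {i} {j} pi≡qj =
  (λ i′ → PathComponent-connected {H = H} {p = p} pc (inImage qc) i i′ (j , pi≡qj)) ,
  (λ j′ → PathComponent-connected {H = H} {p = q} qc (inImage pc) j j′ (i , sym pi≡qj))
  where
  inImage : ∀ {k} {r : Fin k → Fin n} → PathComponent H k r → AdjacencyClosed H (λ v → ∃ λ j → v ≡ r j)
  inImage (_ , _ , closed) (j , refl) vw with closed j _ vw
  ... | j′ , rj′≡w = j′ , sym rj′≡w

δ-pathAdj : ∀ {a b} → (suc a ≡ b) ⊎ (suc b ≡ a) → δ (suc a) b + δ a (suc b) ≡ 1ℤ
δ-pathAdj {a}     (inj₁ refl) = cong₂ _+_ (δ-refl a) (δ-≢ (ℕ.m≢1+n+m a {1}))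
δ-pathAdj {b = b} (inj₂ refl) = cong₂ _+_ (δ-≢ (ℕ.m≢1+n+m b {1} ∘ sym)) (δ-refl b)

δ-notPathAdj : ∀ {a b} → ¬ ((suc a ≡ b) ⊎ (suc b ≡ a)) → δ (suc a) b + δ a (suc b) ≡ 0ℤ
δ-notPathAdj ¬adj = cong₂ _+_ (δ-≢ (¬adj ∘ inj₁)) (δ-≢ (¬adj ∘ inj₂ ∘ sym))

module PathInComplement {n} (G : Graph n) {k} {p : Fin k → Fin n} (pc : PathComponent (complement G) k p) where

  private
    Ā = adj (complement G)
    p-injective = proj₁ pc
    adjacency   = proj₁ (proj₂ pc)
    closed      = proj₂ (proj₂ pc)

  Ā-onPath : ∀ i j → ⟦ Ā (p i) (p j) ⟧ ≡ δ (suc (toℕ i)) (toℕ j) + δ (toℕ i) (suc (toℕ j))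
  Ā-onPath i j with Ā (p i) (p j) in eq
  ... | true  = sym (δ-pathAdj (proj₁ (adjacency i j) eq))
  ... | false = sym (δ-notPathAdj λ ij → contradiction (trans (sym eq) (proj₂ (adjacency i j) ij)) λ ())

  Ā-offPath : ∀ v → (∀ j → p j ≢ v) → ∀ j → ⟦ Ā v (p j) ⟧ ≡ 0ℤ
  Ā-offPath v v∉p j with Ā v (p j) in eq
  ... | true  = let (j′ , pj′≡v) = closed j v (trans (adjSym (complement G) (p j) v) eq) in contradiction pj′≡v (v∉p j′)
  ... | false = refl

  Ā·along : ∀ g → (∀ m → k ≤ m → g m ≡ 0ℤ) → ∀ v → (Ā[ G ]· along p g) v ≡ along p (neighbourSum g) v
  Ā·along g supp v with Fin.any? (λ i → p i Fin.≟ v)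
  ... | yes (i , refl) = begin
    (Ā[ G ]· along p g) (p i)
      ≡⟨ ⟨⟩-along p g (λ u → ⟦ Ā (p i) u ⟧) ⟩
    ∑[ j < k ] (⟦ Ā (p i) (p j) ⟧ * g (toℕ j))
      ≡⟨ sum-cong-≗ {k} (λ j → cong (_* g (toℕ j)) (Ā-onPath i j)) ⟩
    ∑[ j < k ] ((δ (suc (toℕ i)) (toℕ j) + δ (toℕ i) (suc (toℕ j))) * g (toℕ j))
      ≡⟨ ∑-δ-neighbours k g supp (toℕ i) ⟩
    neighbourSum g (toℕ i)
      ≡⟨ along-at p-injective (neighbourSum g) i ⟨
    along p (neighbourSum g) (p i)
      ∎
    where open ≡-Reasoning
  ... | no v∉p = trans (⟨⟩-along p g (λ u → ⟦ Ā v u ⟧))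
    (trans (∑-zero k _ (λ j → cong (_* g (toℕ j)) (Ā-offPath v (λ j pj≡v → v∉p (j , pj≡v)) j)))
           (sym (along-outside p (neighbourSum g) v (λ j pj≡v → v∉p (j , pj≡v)))))

  along-onPath : ∀ g i → along p g (p i) ≡ g (toℕ i)
  along-onPath = along-at p-injective

  N·alternating : ∀ c → suc (c ℕ.* 2) ≤ k → ∀ v →
    (N[ G ]· along p (alternating c)) v
      ≡ ∑[ j < k ] alternating c (toℕ j) - along p (λ m → δ (suc (c ℕ.* 2)) m * alternating c (c ℕ.* 2)) v
  N·alternating c L≤k v = begin
    (N[ G ]· X) v
      ≡⟨ N·≡∑-Ā· G X v ⟩
    sum X - (Ā[ G ]· X) v
      ≡⟨ cong₂ _-_ (∑-along p (alternating c)) (Ā·along (alternating c) supp v) ⟩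
    ∑[ j < k ] alternating c (toℕ j) - along p (neighbourSum (alternating c)) v
      ≡⟨ cong (λ z → ∑[ j < k ] alternating c (toℕ j) - z)
              (sum-cong-≗ {k} (λ j → cong (basis (p j) v *_) (neighbourSum-alternating c (toℕ j)))) ⟩
    ∑[ j < k ] alternating c (toℕ j) - along p (λ m → δ (suc (c ℕ.* 2)) m * alternating c (c ℕ.* 2)) v
      ∎
    where
    open ≡-Reasoning
    X = along p (alternating c)
    supp : ∀ m → k ≤ m → alternating c m ≡ 0ℤ
    supp m k≤m = alternating-support c m (ℕ.≤-trans L≤k k≤m)

  N·alternating-whole : ∀ c → suc (c ℕ.* 2) ≡ k → ∀ v →
    (N[ G ]· along p (alternating c)) v ≡ ∑[ j < k ] alternating c (toℕ j)
  N·alternating-whole c L≡k v =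
    trans (N·alternating c (ℕ.≤-reflexive L≡k) v)
          (trans (cong (_-_ (∑[ j < k ] alternating c (toℕ j))) (along-vanishing p endpoint beyondPath v))
                 (+-identityʳ _))
    where
    endpoint : ℕ → ℤ
    endpoint m = δ (suc (c ℕ.* 2)) m * alternating c (c ℕ.* 2)
    beyondPath : ∀ j → endpoint (toℕ j) ≡ 0ℤ
    beyondPath j = cong (_* alternating c (c ℕ.* 2)) (δ-≢ λ L≡j → ℕ.<-irrefl (trans (sym L≡j) L≡k) (toℕ<n j))

-- Adding a missing edge

complement-adj⇒¬adj : ∀ {n} (G : Graph n) {v w} → adj (complement G) v w ≡ true → adj G v w ≡ false
complement-adj⇒¬adj G {v} {w} vw with adj G v w
... | false = refl

module AddEdge {n} (G : Graph n) {a b : Fin n} (a≢b : a ≢ b) (ab∉G : adj G a b ≡ false) where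

  infix 7 _≡ᶠ_
  _≡ᶠ_ : Fin n → Fin n → Bool
  x ≡ᶠ y = toℕ x ≡ᵇ toℕ y

  isAB : Fin n → Fin n → Bool
  isAB i j = (a ≡ᶠ i ∧ b ≡ᶠ j) ∨ (b ≡ᶠ i ∧ a ≡ᶠ j)

  ⟦isAB⟧ : ∀ i j → ⟦ isAB i j ⟧ ≡ basis a i * basis b j + basis b i * basis a j
  ⟦isAB⟧ i j = trans (⟦∨⟧ (a ≡ᶠ i ∧ b ≡ᶠ j) (b ≡ᶠ i ∧ a ≡ᶠ j) noOverlap)
                     (cong₂ _+_ (⟦∧⟧ (a ≡ᶠ i) (b ≡ᶠ j)) (⟦∧⟧ (b ≡ᶠ i) (a ≡ᶠ j)))
    where
    regroup : ∀ α β γ δ → α * β * (γ * δ) ≡ α * γ * (β * δ)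
    regroup = solve-∀
    noOverlap : ⟦ a ≡ᶠ i ∧ b ≡ᶠ j ⟧ * ⟦ b ≡ᶠ i ∧ a ≡ᶠ j ⟧ ≡ 0ℤ
    noOverlap = trans (cong₂ _*_ (⟦∧⟧ (a ≡ᶠ i) (b ≡ᶠ j)) (⟦∧⟧ (b ≡ᶠ i) (a ≡ᶠ j)))
      (trans (regroup (basis a i) (basis b j) (basis b i) (basis a j))
             (cong (_* (basis b j * basis a j)) (basis-disjoint a≢b i)))

  isAB-sym : ∀ i j → isAB i j ≡ isAB j i
  isAB-sym i j = trans (∨-comm (a ≡ᶠ i ∧ b ≡ᶠ j) (b ≡ᶠ i ∧ a ≡ᶠ j))
                       (cong₂ _∨_ (∧-comm (b ≡ᶠ i) (a ≡ᶠ j)) (∧-comm (a ≡ᶠ i) (b ≡ᶠ j)))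

  ⟦isAB-diagonal⟧ : ∀ i → basis a i * basis b i + basis b i * basis a i ≡ 0ℤ
  ⟦isAB-diagonal⟧ i =
    cong₂ _+_ (basis-disjoint a≢b i) (trans (*-comm (basis b i) (basis a i)) (basis-disjoint a≢b i))

  H : Graph n
  H = record
    { adj    = λ i j → adj G i j ∨ isAB i j
    ; adjSym = λ i j → cong₂ _∨_ (adjSym G i j) (isAB-sym i j)
    ; adjIrr = λ i → cong₂ _∨_ (adjIrr G i) (⟦⟧≡0 (trans (⟦isAB⟧ i i) (⟦isAB-diagonal⟧ i)))
    }

  ⟦adj-H⟧ : ∀ i j → ⟦ adj H i j ⟧ ≡ ⟦ adj G i j ⟧ + (basis a i * basis b j + basis b i * basis a j)
  ⟦adj-H⟧ i j = trans (⟦∨⟧ (adj G i j) (isAB i j) (trans (cong (⟦ adj G i j ⟧ *_) (⟦isAB⟧ i j)) noOverlap))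
                      (cong (_+_ ⟦ adj G i j ⟧) (⟦isAB⟧ i j))
    where
    g : Fin n → Fin n → ℤ
    g i j = ⟦ adj G i j ⟧
    pinned : ∀ x y → basis x i * (basis y j * g i j) ≡ basis x i * (basis y j * g x y)
    pinned x y = begin
      basis x i * (basis y j * g i j) ≡⟨ cong (basis x i *_) (basis-subst y (g i) j) ⟩
      basis x i * (basis y j * g i y) ≡⟨ swap (basis x i) (basis y j) (g i y) ⟩
      basis y j * (basis x i * g i y) ≡⟨ cong (basis y j *_) (basis-subst x (λ i → g i y) i) ⟩
      basis y j * (basis x i * g x y) ≡⟨ swap (basis y j) (basis x i) (g x y) ⟩
      basis x i * (basis y j * g x y) ∎
      where
      open ≡-Reasoning
      swap : ∀ x y z → x * (y * z) ≡ y * (x * z)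
      swap = solve-∀
    ba∉G : adj G b a ≡ false
    ba∉G = trans (adjSym G b a) ab∉G
    expand : ∀ g α β γ δ → g * (α * β + γ * δ) ≡ α * (β * g) + γ * (δ * g)
    expand = solve-∀
    vanish : ∀ α β γ δ → α * (β * 0ℤ) + γ * (δ * 0ℤ) ≡ 0ℤ
    vanish = solve-∀
    noOverlap : g i j * (basis a i * basis b j + basis b i * basis a j) ≡ 0ℤ
    noOverlap = begin
      g i j * (basis a i * basis b j + basis b i * basis a j)
        ≡⟨ expand (g i j) (basis a i) (basis b j) (basis b i) (basis a j) ⟩
      basis a i * (basis b j * g i j) + basis b i * (basis a j * g i j)
        ≡⟨ cong₂ _+_ (pinned a b) (pinned b a) ⟩
      basis a i * (basis b j * g a b) + basis b i * (basis a j * g b a)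
        ≡⟨ cong₂ (λ x y → basis a i * (basis b j * ⟦ x ⟧) + basis b i * (basis a j * ⟦ y ⟧)) ab∉G ba∉G ⟩
      basis a i * (basis b j * 0ℤ) + basis b i * (basis a j * 0ℤ)
        ≡⟨ vanish (basis a i) (basis b j) (basis b i) (basis a j) ⟩
      0ℤ
        ∎
      where open ≡-Reasoning

  ⟦inN-H⟧ : ∀ v u → ⟦ inN[ H ] v u ⟧ ≡ ⟦ inN[ G ] v u ⟧ + (basis a v * basis b u + basis b v * basis a u)
  ⟦inN-H⟧ v u with v Fin.≟ u
  ... | yes refl = sym (cong (_+_ 1ℤ) (⟦isAB-diagonal⟧ v))
  ... | no _     = ⟦adj-H⟧ v u

  N·-H : ∀ t v → (N[ H ]· t) v ≡ (N[ G ]· t) v + (basis a v * t b + basis b v * t a)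
  N·-H t v = begin
    ∑[ u < n ] (⟦ inN[ H ] v u ⟧ * t u)
      ≡⟨ sum-cong-≗ {n} (λ u → trans (cong (_* t u) (⟦inN-H⟧ v u))
                                      (expand ⟦ inN[ G ] v u ⟧ (basis a v) (basis b u) (basis b v) (basis a u) (t u))) ⟩
    ∑[ u < n ] (⟦ inN[ G ] v u ⟧ * t u + (basis a v * (basis b u * t u) + basis b v * (basis a u * t u)))
      ≡⟨ ∑-distrib-+ (λ u → ⟦ inN[ G ] v u ⟧ * t u) _ ⟩
    (N[ G ]· t) v + ∑[ u < n ] (basis a v * (basis b u * t u) + basis b v * (basis a u * t u))
      ≡⟨ cong (_+_ ((N[ G ]· t) v)) (∑-distrib-+ (λ u → basis a v * (basis b u * t u)) _) ⟩
    (N[ G ]· t) v + (∑[ u < n ] (basis a v * (basis b u * t u)) + ∑[ u < n ] (basis b v * (basis a u * t u)))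
      ≡⟨ cong (_+_ ((N[ G ]· t) v)) (cong₂ _+_ (pull (basis a v) b) (pull (basis b v) a)) ⟩
    (N[ G ]· t) v + (basis a v * t b + basis b v * t a) ∎
    where
    open ≡-Reasoning
    expand : ∀ c α β γ δ t → (c + (α * β + γ * δ)) * t ≡ c * t + (α * (β * t) + γ * (δ * t))
    expand = solve-∀
    pull : ∀ x e → ∑[ u < n ] (x * (basis e u * t u)) ≡ x * t e
    pull x e = trans (sym (*-distribˡ-sum x (λ u → basis e u * t u))) (cong (x *_) (∑-basis e t))

  edges-H : edges H ≡ suc (edges G)
  edges-H = +-injective (begin
    + edges H                                                     ≡⟨ +edges H ⟩
    ∑[ i < n ] ∑[ j < n ] (lt i j * ⟦ adj H i j ⟧)
      ≡⟨ sum-cong-≗ {n} (λ i → sum-cong-≗ {n} (λ j → split i j)) ⟩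
    ∑[ i < n ] ∑[ j < n ] (lt i j * ⟦ adj G i j ⟧ + (ab i j + ba i j))
      ≡⟨ sum-cong-≗ {n} (λ i → trans (∑-distrib-+ (λ j → lt i j * ⟦ adj G i j ⟧) (λ j → ab i j + ba i j))
                                      (cong (_+_ (∑[ j < n ] (lt i j * ⟦ adj G i j ⟧))) (∑-distrib-+ (ab i) (ba i)))) ⟩
    ∑[ i < n ] (∑[ j < n ] (lt i j * ⟦ adj G i j ⟧) + (∑[ j < n ] ab i j + ∑[ j < n ] ba i j))
      ≡⟨ trans (∑-distrib-+ (λ i → ∑[ j < n ] (lt i j * ⟦ adj G i j ⟧)) (λ i → ∑[ j < n ] ab i j + ∑[ j < n ] ba i j))
               (cong (_+_ (∑[ i < n ] ∑[ j < n ] (lt i j * ⟦ adj G i j ⟧)))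
                     (∑-distrib-+ (λ i → ∑[ j < n ] ab i j) (λ i → ∑[ j < n ] ba i j))) ⟩
    ∑[ i < n ] ∑[ j < n ] (lt i j * ⟦ adj G i j ⟧) + (∑[ i < n ] ∑[ j < n ] ab i j + ∑[ i < n ] ∑[ j < n ] ba i j)
      ≡⟨ cong₂ _+_ (sym (+edges G)) (cong₂ _+_ (∑∑-basis a b) (∑∑-basis b a)) ⟩
    + edges G + (lt a b + lt b a)                                 ≡⟨ cong (_+_ (+ edges G)) lt-total ⟩
    + edges G + 1ℤ                                                ≡⟨ +-comm (+ edges G) 1ℤ ⟩
    + suc (edges G)                                               ∎)
    where
    open ≡-Reasoning
    lt : Fin n → Fin n → ℤ
    lt i j = ⟦ ⌊ toℕ i ℕ.<? toℕ j ⌋ ⟧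
    ab ba : Fin n → Fin n → ℤ
    ab i j = lt i j * (basis a i * basis b j)
    ba i j = lt i j * (basis b i * basis a j)
    +if : ∀ c x → + (if c then b2n x else 0) ≡ ⟦ c ⟧ * ⟦ x ⟧
    +if true  x = sym (*-identityˡ ⟦ x ⟧)
    +if false x = refl
    +edges : ∀ K → + edges K ≡ ∑[ i < n ] ∑[ j < n ] (lt i j * ⟦ adj K i j ⟧)
    +edges K = trans (+-sumFin n _) (sum-cong-≗ {n} (λ i → trans (+-sumFin n _)
                 (sum-cong-≗ {n} (λ j → +if ⌊ toℕ i ℕ.<? toℕ j ⌋ (adj K i j)))))
    split : ∀ i j → lt i j * ⟦ adj H i j ⟧ ≡ lt i j * ⟦ adj G i j ⟧ + (ab i j + ba i j)
    split i j = trans (cong (lt i j *_) (⟦adj-H⟧ i j))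
                      (distrib (lt i j) ⟦ adj G i j ⟧ (basis a i) (basis b j) (basis b i) (basis a j))
      where
      distrib : ∀ l g α β γ δ → l * (g + (α * β + γ * δ)) ≡ l * g + (l * (α * β) + l * (γ * δ))
      distrib = solve-∀
    ∑∑-basis : ∀ x y → ∑[ i < n ] ∑[ j < n ] (lt i j * (basis x i * basis y j)) ≡ lt x y
    ∑∑-basis x y = trans (sum-cong-≗ {n} (λ i → trans (sum-cong-≗ {n} (λ j → rearrange (lt i j) (basis x i) (basis y j)))
                                          (trans (sym (*-distribˡ-sum (basis x i) (λ j → basis y j * lt i j)))
                                                 (cong (basis x i *_) (∑-basis y (lt i))))))
                         (∑-basis x (λ i → lt i y))
      where
      rearrange : ∀ l α β → l * (α * β) ≡ α * (β * l)
      rearrange = solve-∀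
    lt-total : lt a b + lt b a ≡ 1ℤ
    lt-total with toℕ a ℕ.<? toℕ b | toℕ b ℕ.<? toℕ a
    ... | yes a<b | yes b<a = contradiction b<a (ℕ.<-asym a<b)
    ... | yes _   | no _    = refl
    ... | no _    | yes _   = refl
    ... | no a≮b  | no b≮a  = contradiction (toℕ-injective (ℕ.≤-antisym (ℕ.≮⇒≥ b≮a) (ℕ.≮⇒≥ a≮b))) a≢b

  -- By N·-H, N_H U = basis b. If N_G t₂ ≡ basis a, self-adjointness gives t₂ b ≡ ⟨ U , basis a ⟩ = U a = 0,
  -- hence basis a ≡ N_H t₂ − t₂ a · basis b; and y ≡ N_G t₁ = N_H t₁ − t₁ b · basis a − t₁ a · basis b.
  NAWℤ-H : ∀ {ℓ} → NAWℤ G ℓ →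
    (U : Vector ℤ n) → (∀ v → (N[ G ]· U) v ≡ basis b v) → U a ≡ 0ℤ → U b ≡ 0ℤ → NAWℤ H ℓ
  NAWℤ-H {ℓ} nawℤ U N·U≡b Ua≡0 Ub≡0 y =
    Reachable-resp H y≡N·t₁-corrections
      (Reachable-lincomb H (Reachable-lincomb H (Reachable-image H t₁) reach-a (- t₁ b)) reach-b (- t₁ a))
    where
    t₁ = proj₁ (nawℤ y)
    t₂ = proj₁ (nawℤ (basis a))
    N·U≡b-H : ∀ v → (N[ H ]· U) v ≡ basis b v
    N·U≡b-H v = trans (N·-H U v) (trans (cong₂ (λ x z → (N[ G ]· U) v + (basis a v * x + basis b v * z)) Ub≡0 Ua≡0)
                      (trans (cong (_+ _) (N·U≡b v)) (cleanup (basis b v) (basis a v))))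
      where
      cleanup : ∀ x y → x + (y * 0ℤ + x * 0ℤ) ≡ x
      cleanup = solve-∀
    reach-b : Reachable H ℓ (basis b)
    reach-b = Reachable-resp H {basis b}
      (λ v → subst (λ z → z ≡ (N[ H ]· U) v [mod ℓ ]) (N·U≡b-H v) (≡mod-refl {(N[ H ]· U) v})) (Reachable-image H U)
    t₂b≡0 : t₂ b ≡ 0ℤ [mod ℓ ]
    t₂b≡0 = subst₂ (λ u w → u ≡ w [mod ℓ ])
      (trans (sum-cong-≗ {n} (λ v → cong (_* t₂ v) (N·U≡b v))) (∑-basis b t₂)) (trans (⟨⟩-basisʳ U a) Ua≡0)
      (pairing G U (proj₂ (nawℤ (basis a))))
    reach-a : Reachable H ℓ (basis a)
    reach-a = Reachable-resp H {basis a} (λ v → ≡mod-sym {(N[ H ]· t₂) v + - t₂ a * basis b v} (a≡ v))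
                (Reachable-lincomb H (Reachable-image H t₂) reach-b (- t₂ a))
      where
      rearrange : ∀ N α β p q → N + (α * q + β * p) + - p * β - α ≡ N - α + α * q
      rearrange = solve-∀
      a≡ : ∀ v → (N[ H ]· t₂) v + - t₂ a * basis b v ≡ basis a v [mod ℓ ]
      a≡ v = subst (_ ∣_)
        (sym (trans (cong (λ z → z + - t₂ a * basis b v - basis a v) (N·-H t₂ v))
                    (rearrange ((N[ G ]· t₂) v) (basis a v) (basis b v) (t₂ a) (t₂ b))))
        (∣m∣n⇒∣m+n (proj₂ (nawℤ (basis a)) v) (∣n⇒∣m*n (basis a v) (subst (_ ∣_) (+-identityʳ (t₂ b)) t₂b≡0)))
    y≡N·t₁-corrections : ∀ v → y v ≡ (N[ H ]· t₁) v + - t₁ b * basis a v + - t₁ a * basis b v [mod ℓ ]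
    y≡N·t₁-corrections v = subst (λ z → y v ≡ z [mod ℓ ])
      (sym (trans (cong (λ z → z + - t₁ b * basis a v + - t₁ a * basis b v) (N·-H t₁ v))
                  (cancel ((N[ G ]· t₁) v) (basis a v) (basis b v) (t₁ a) (t₁ b))))
      (≡mod-sym {(N[ G ]· t₁) v} {y v} (proj₂ (nawℤ y) v))
      where
      cancel : ∀ N α β p q → N + (α * q + β * p) + - q * α + - p * β ≡ N
      cancel = solve-∀

-- The quotient is doubled twice so that k ≡ suc (c * 2) holds for c = q * 2 or c = suc (q * 2).
k≡r+q*2*2 : ∀ {k r} → k % 4 ≡ r → k ≡ r ℕ.+ k ℕ./ 4 ℕ.* 2 ℕ.* 2
k≡r+q*2*2 {k} k%4≡r = trans (ℕ.m≡m%n+[m/n]*n k 4) (cong₂ ℕ._+_ k%4≡r (sym (ℕ.*-assoc (k ℕ./ 4) 2 2)))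

no-3mod4-path : ∀ {n ℓ} → 2 ≤ ℓ → (G : Graph n) → NAWℤ G ℓ →
  ∀ k → k % 4 ≡ 3 → (p : Fin k → Fin n) → ¬ PathComponent (complement G) k p
no-3mod4-path 2≤ℓ G nawℤ k k%4≡3 p pc =
  ¬NAWℤ-kernel 2≤ℓ G nawℤ (along p (alternating c)) (p start) N·X≡0
    (trans (along-onPath (alternating c) start) (cong (alternating c) (toℕ-fromℕ< 0<k)))
  where
  open PathInComplement G pc
  q = k ℕ./ 4
  c = suc (q ℕ.* 2)
  L≡k : suc (c ℕ.* 2) ≡ k
  L≡k = sym (k≡r+q*2*2 k%4≡3)
  0<k = subst (0 <_) L≡k (ℕ.s≤s ℕ.z≤n)
  start = fromℕ< 0<k
  N·X≡0 : ∀ v → (N[ G ]· along p (alternating c)) v ≡ 0ℤ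
  N·X≡0 v = trans (N·alternating-whole c L≡k v) (∑-alternating-odd q k (ℕ.≤-reflexive L≡k))

unique-1mod4-path : ∀ {n ℓ} → 2 ≤ ℓ → (G : Graph n) → NAWℤ G ℓ →
  ∀ k k′ → k % 4 ≡ 1 → k′ % 4 ≡ 1 → (p : Fin k → Fin n) (q : Fin k′ → Fin n) →
  PathComponent (complement G) k p → PathComponent (complement G) k′ q → SameImage p q
unique-1mod4-path {n} 2≤ℓ G nawℤ k k′ k%4≡1 k′%4≡1 p q pc qc
  with Fin.any? (λ i → Fin.any? (λ j → p i Fin.≟ q j))
... | yes (i , j , pi≡qj) = PathComponent-sameImage {H = complement G} {p = p} {q} pc qc pi≡qj
... | no disjoint = ⊥-elim $ ¬NAWℤ-kernel 2≤ℓ G nawℤ (λ v → X v - Y v) (p start) N·[X-Y]≡0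
    (cong₂ _-_ (trans (P.along-onPath (alternating (r ℕ.* 2)) start)
                      (trans (cong (alternating (r ℕ.* 2)) (toℕ-fromℕ< 0<k)) (alternating-head (r ℕ.* 2))))
               (along-outside q (alternating (r′ ℕ.* 2)) (p start) (λ j qj≡p → disjoint (start , j , sym qj≡p))))
  where
  module P = PathInComplement G pc
  module Q = PathInComplement G qc
  r  = k ℕ./ 4
  r′ = k′ ℕ./ 4
  X = along p (alternating (r ℕ.* 2))
  Y = along q (alternating (r′ ℕ.* 2))
  L≡k : suc (r ℕ.* 2 ℕ.* 2) ≡ k
  L≡k = sym (k≡r+q*2*2 k%4≡1)
  L′≡k′ : suc (r′ ℕ.* 2 ℕ.* 2) ≡ k′
  L′≡k′ = sym (k≡r+q*2*2 k′%4≡1)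
  0<k = subst (0 <_) L≡k (ℕ.s≤s ℕ.z≤n)
  start = fromℕ< 0<k
  N·[X-Y]≡0 : ∀ v → (N[ G ]· (λ v → X v - Y v)) v ≡ 0ℤ
  N·[X-Y]≡0 v = trans (N·-- G X Y v) (cong₂ _-_
    (trans (P.N·alternating-whole (r ℕ.* 2) L≡k v) (∑-alternating-even r k (ℕ.≤-reflexive L≡k)))
    (trans (Q.N·alternating-whole (r′ ℕ.* 2) L′≡k′ v) (∑-alternating-even r′ k′ (ℕ.≤-reflexive L′≡k′))))

no-long-path-in-extremal : ∀ {n ℓ} .{{_ : NonZero ℓ}} (G : Graph n) → Extremal G ℓ →
  ∀ k → 4 < k → (p : Fin k → Fin n) → ¬ PathComponent (complement G) k p
no-long-path-in-extremal {n} {ℓ} G (naw , maximal) k 4<k p pc =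
  ℕ.<-irrefl refl (subst (_≤ edges G) E.edges-H (maximal E.H
    (NAWℤ⇒NAW ℓ E.H (E.NAWℤ-H (NAW⇒NAWℤ ℓ G naw) X N·X≡basis-b
                               (beyondPattern 4 4<k (ℕ.n≤1+n 3)) (beyondPattern 3 3<k ℕ.≤-refl)))))
  where
  open PathInComplement G pc
  3<k : 3 < k
  3<k = ℕ.<-trans (ℕ.n<1+n 3) 4<k
  i₃ = fromℕ< 3<k
  i₄ = fromℕ< 4<k
  a≢b : p i₄ ≢ p i₃
  a≢b e = contradiction (trans (sym (toℕ-fromℕ< 4<k)) (trans (cong toℕ (proj₁ pc e)) (toℕ-fromℕ< 3<k))) λ ()
  ab∉G : adj G (p i₄) (p i₃) ≡ false
  ab∉G = complement-adj⇒¬adj G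
    (proj₂ (proj₁ (proj₂ pc) i₄ i₃) (inj₂ (trans (cong suc (toℕ-fromℕ< 3<k)) (sym (toℕ-fromℕ< 4<k)))))
  module E = AddEdge G a≢b ab∉G
  X = along p (alternating 1)
  beyondPattern : ∀ m (m<k : m < k) → 3 ≤ m → X (p (fromℕ< m<k)) ≡ 0ℤ
  beyondPattern m m<k 3≤m =
    trans (along-onPath (alternating 1) (fromℕ< m<k)) (trans (cong (alternating 1) (toℕ-fromℕ< m<k)) (alternating-support 1 m 3≤m))
  N·X≡basis-b : ∀ v → (N[ G ]· X) v ≡ basis (p i₃) v
  N·X≡basis-b v = trans (N·alternating 1 (ℕ.<⇒≤ 3<k) v)
    (trans (cong₂ _-_ (∑-alternating-odd 0 k (ℕ.<⇒≤ 3<k))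
                      (trans (cong (λ z → along p (λ m → δ z m * - 1ℤ) v) (sym (toℕ-fromℕ< 3<k)))
                             (along-basis p i₃ (- 1ℤ) v)))
           (negate (basis (p i₃) v)))
    where
    negate : ∀ x → 0ℤ - x * - 1ℤ ≡ x
    negate = solve-∀

corollary3p2 : (ℓ : ℕ) → 2 ≤ ℓ → (n : ℕ) → (G : Graph n) → NAW G ℓ →
    ((k : ℕ) → k % 4 ≡ 3 → (p : Fin k → Fin n) → ¬ PathComponent (complement G) k p)
    × ((k k' : ℕ) → k % 4 ≡ 1 → k' % 4 ≡ 1 → (p : Fin k → Fin n) → (q : Fin k' → Fin n) →
        PathComponent (complement G) k p → PathComponent (complement G) k' q → SameImage p q)
    × (Extremal G ℓ → (k : ℕ) → 4 < k → (p : Fin k → Fin n) → ¬ PathComponent (complement G) k p)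
corollary3p2 ℓ 2≤ℓ n G naw =
  no-3mod4-path 2≤ℓ G nawℤ , unique-1mod4-path 2≤ℓ G nawℤ , no-long-path-in-extremal G
  where
  instance
    ℓ-nonZero : NonZero ℓ
    ℓ-nonZero = ℕ.>-nonZero (ℕ.<-≤-trans (ℕ.s≤s ℕ.z≤n) 2≤ℓ)
  nawℤ = NAW⇒NAWℤ ℓ G naw
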